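{- Let $\mathcal{D}$ be a Ryser design of order $v$ and index $\lambda$ with replication numbers $r_1>r_2$, and let $g=\gcd(r_1-1,r_2-1)$, $c=(r_1-1)/g$, $d=(r_2-1)/g$ and $a=c-d$. Let $A$ be a block of $\mathcal{D}$. Then $|A|=2\lambda+ta$ for some integer $t$. The block $A$ is large, average or small according as $t>0$, $t=0$ or $t<0$ respectively. Moreover, $\tau_1(A)=\tau_2(A)=\lambda$ if $A$ is average, $\tau_1(A)>\lambda>\tau_2(A)$ if $A$ is small, and $\tau_2(A)>\lambda>\tau_1(A)$ if $A$ is large.
   Context: A Ryser design of order $v$ and index $\lambda$ is a pair $(X,L)$ where $X$ is a set of $v$ points and $L$ is a collection of $v$ subsets of $X$ (blocks) such that any two distinct blocks meet in exactly $\lambda$ points, every block has more than $\lambda$ points, and not all blocks have the same size. It is known (Ryser–Woodall) that there are integers $r_1>r_2$ with $r_1+r_2=v+1$ such that every point lies in exactly $r_1$ or exactly $r_2$ blocks; these are the replication numbers. For $i=1,2$, $E_i$ is the set of points with replication number $r_i$, and for a block $A$, $\tau_i(A)=|A\cap E_i|$. A block $A$ is called large, average or small if $|A|>2\lambda$, $|A|=2\lambda$, or $|A|<2\lambda$ respectively. -}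

module Defs where

open import Data.Nat using (ℕ; _<_; _*_)
open import Data.Nat.Properties using (_≟_)
open import Data.Bool using (Bool)
open import Data.Fin using (Fin)
open import Data.Fin.Subset using (Subset; _∩_; ∣_∣)
open import Data.Vec using (tabulate; lookup)
open import Data.Product using (_×_; ∃₂)
open import Relation.Binary.PropositionalEquality using (_≡_; _≢_)
open import Relation.Nullary.Decidable using (⌊_⌋)

Blocks : ℕ → Set
Blocks v = Fin v → Subset v

record IsRyserDesign (v λ′ : ℕ) (B : Blocks v) : Set where
  field
    intersect : ∀ i j → i ≢ j → ∣ B i ∩ B j ∣ ≡ λ′
    bigger    : ∀ i → λ′ < ∣ B i ∣
    nonUniform : ∃₂ λ i j → ∣ B i ∣ ≢ ∣ B j ∣

replication : ∀ {v} → Blocks v → Fin v → ℕ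
replication B x = ∣ tabulate (λ j → lookup (B j) x) ∣

E : ∀ {v} → Blocks v → ℕ → Subset v
E B r = tabulate (λ x → ⌊ replication B x ≟ r ⌋)

τ : ∀ {v} → Blocks v → ℕ → Subset v → ℕ
τ B r A = ∣ A ∩ E B r ∣

Large Average Small : ∀ {v′} → ℕ → Subset v′ → Set
Large   {v′} λ′ A = 2 * λ′ < ∣ A ∣
Average {v′} λ′ A = ∣ A ∣ ≡ 2 * λ′
Small   {v′} λ′ A = ∣ A ∣ < 2 * λ′

-- Double counting the incidences between the blocks and the points of a block A gives
-- r₁ τ₁ + r₂ τ₂ + λ = |A| + v λ. With |A| = τ₁ + τ₂ and r₁ + r₂ = v + 1 this becomes the balance
-- (r₁ − 1)(λ − τ₁) = (r₂ − 1)(τ₂ − λ). Dividing by g leaves the coprime c and d, so τ₂ − λ = t c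
-- and λ − τ₁ = t d for an integer t; then |A| = 2λ + t (c − d), and since 0 < d < c every claim is
-- decided by the sign of t. That d > 0, i.e. r₂ ≥ 2, needs the design: r₂ = 0 would force
-- r₁ = v + 1 replications, more than there are blocks, and r₂ = 1 would give τ₁ = λ and, counting
-- the points of E₂ once each, τ₂ = 1 for every block, so that all blocks would have size λ + 1.

module Submission where

open import Defs
import Data.Nat.Properties as ℕP
open import Data.Bool using (Bool; true; false; _∧_)
open import Data.Empty using (⊥-elim)
open import Data.Fin using (Fin; zero; suc; punchIn)
open import Data.Fin.Subset using (Subset; _∩_; ∣_∣)
open import Data.Product using (_×_; _,_; ∃; ∃₂; proj₁; proj₂)
open import Data.Sum using (_⊎_; inj₁; inj₂; [_,_]′)
open import Function using (_∘_)
open import Function.Bundles using (_⇔_; mk⇔; Equivalence)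
open import Relation.Binary.Definitions using (Tri; tri<; tri≈; tri>)
open import Relation.Binary.PropositionalEquality
open import Relation.Nullary using (¬_)

module Counting where

  open import Algebra.Properties.Semiring.Sum ℕP.+-*-semiring
    using (sum; sum-syntax; sum-cong-≗; sum-remove; sum-replicate-zero; ∑-comm; ∑-distrib-+; *-distribˡ-sum; *-distribʳ-sum)
  open import Data.Fin.Properties using (punchInᵢ≢i)
  open import Data.Fin.Subset.Properties using (∩-idem; ∣p∣≤n; ∣p∩q∣≤∣q∣)
  open import Data.Nat using (ℕ; zero; suc; _+_; _*_; _≤_; _<_; z≤n)
  open import Data.Nat.Tactic.RingSolver using (solve-∀)
  open import Data.Vec using ([]; _∷_; lookup; tabulate)
  open import Data.Vec.Functional using (Vector; removeAt)
  open import Data.Vec.Properties using (lookup∘tabulate; lookup-zipWith)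
  open import Relation.Nullary using (yes; no)
  open import Relation.Nullary.Decidable using (⌊_⌋; isYes≗does; dec-false)
  open ℕP using (_≟_)

  [_]ᵇ : Bool → ℕ
  [ true ]ᵇ = 1
  [ false ]ᵇ = 0

  [∧]ᵇ : ∀ a b → [ a ∧ b ]ᵇ ≡ [ a ]ᵇ * [ b ]ᵇ
  [∧]ᵇ true b = sym (ℕP.+-identityʳ [ b ]ᵇ)
  [∧]ᵇ false b = refl

  χ : ∀ {n} → Subset n → Fin n → ℕ
  χ p x = [ lookup p x ]ᵇ

  ∣p∣≡∑ : ∀ {n} (p : Subset n) → ∣ p ∣ ≡ ∑[ x < n ] χ p x
  ∣p∣≡∑ [] = refl
  ∣p∣≡∑ (true ∷ p) = cong suc (∣p∣≡∑ p)
  ∣p∣≡∑ (false ∷ p) = ∣p∣≡∑ p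

  ∣p∩q∣≡∑ : ∀ {n} (p q : Subset n) → ∣ p ∩ q ∣ ≡ ∑[ x < n ] (χ p x * χ q x)
  ∣p∩q∣≡∑ p q = trans (∣p∣≡∑ (p ∩ q)) (sum-cong-≗ λ x →
    trans (cong [_]ᵇ (lookup-zipWith _∧_ x p q)) ([∧]ᵇ (lookup p x) (lookup q x)))

  ∑-const : ∀ n k → ∑[ _ < n ] k ≡ n * k
  ∑-const zero k = refl
  ∑-const (suc n) k = cong (k +_) (∑-const n k)

  ∑-mono-≤ : ∀ {n} {f g : Vector ℕ n} → (∀ i → f i ≤ g i) → sum f ≤ sum g
  ∑-mono-≤ {zero} f≤g = z≤n
  ∑-mono-≤ {suc n} f≤g = ℕP.+-mono-≤ (f≤g zero) (∑-mono-≤ (f≤g ∘ suc))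

  ∑-except : ∀ {n} (f : Vector ℕ n) i {k} → (∀ j → j ≢ i → f j ≡ k) → sum f + k ≡ f i + n * k
  ∑-except {suc n} f i {k} others = begin
    sum f + k                     ≡⟨ cong (_+ k) (sum-remove f) ⟩
    f i + sum (removeAt f i) + k  ≡⟨ cong (λ s → f i + s + k) (sum-cong-≗ λ j → others (punchIn i j) (punchInᵢ≢i i j)) ⟩
    f i + ∑[ _ < n ] k + k        ≡⟨ cong (λ s → f i + s + k) (∑-const n k) ⟩
    f i + n * k + k               ≡⟨ move-right (f i) (n * k) k ⟩
    f i + suc n * k               ∎
    where
    open ≡-Reasoning
    move-right : ∀ a b c → a + b + c ≡ a + (c + b)
    move-right = solve-∀

  ∑≤n⇒≤1 : ∀ {n} (f : Vector ℕ n) → (∀ i → 1 ≤ f i) → sum f ≤ n → ∀ i → f i ≤ 1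
  ∑≤n⇒≤1 {suc n} f f≥1 ∑f≤n i = ℕP.+-cancelʳ-≤ n (f i) 1 (begin
    f i + n                      ≡⟨ cong (f i +_) (ℕP.*-identityʳ n) ⟨
    f i + n * 1                  ≡⟨ cong (f i +_) (∑-const n 1) ⟨
    f i + ∑[ _ < n ] 1           ≤⟨ ℕP.+-monoʳ-≤ (f i) (∑-mono-≤ (λ j → f≥1 (punchIn i j))) ⟩
    f i + sum (removeAt f i)     ≡⟨ sum-remove f ⟨
    sum f                        ≤⟨ ∑f≤n ⟩
    suc n                        ∎)
    where open ℕP.≤-Reasoning

  [y≟r]*y≡[y≟r]*r : ∀ y r → [ ⌊ y ≟ r ⌋ ]ᵇ * y ≡ [ ⌊ y ≟ r ⌋ ]ᵇ * r
  [y≟r]*y≡[y≟r]*r y r with y ≟ r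
  ... | yes refl = refl
  ... | no _ = refl

  [≟]-partition : ∀ {y r₁ r₂} → r₁ ≢ r₂ → y ≡ r₁ ⊎ y ≡ r₂ →
                  [ ⌊ y ≟ r₁ ⌋ ]ᵇ + [ ⌊ y ≟ r₂ ⌋ ]ᵇ ≡ 1
  [≟]-partition {y} {r₁} {r₂} r₁≢r₂ y∈ with y ≟ r₁ | y ≟ r₂
  ... | yes refl | yes refl = ⊥-elim (r₁≢r₂ refl)
  ... | yes refl | no _ = refl
  ... | no _ | yes refl = refl
  ... | no y≢r₁ | no y≢r₂ = ⊥-elim ([ y≢r₁ , y≢r₂ ]′ y∈)

  module _ {v : ℕ} (B : Blocks v) where

    replication≡∑ : ∀ x → replication B x ≡ ∑[ j < v ] χ (B j) x
    replication≡∑ x = trans (∣p∣≡∑ (tabulate (λ j → lookup (B j) x)))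
                            (sum-cong-≗ λ j → cong [_]ᵇ (lookup∘tabulate (λ j → lookup (B j) x) j))

    lookup-E : ∀ r x → lookup (E B r) x ≡ ⌊ replication B x ≟ r ⌋
    lookup-E r x = lookup∘tabulate (λ y → ⌊ replication B y ≟ r ⌋) x

    ∑∣B∩T∣≡∑replication : ∀ T → ∑[ j < v ] ∣ B j ∩ T ∣ ≡ ∑[ x < v ] (replication B x * χ T x)
    ∑∣B∩T∣≡∑replication T = begin
      ∑[ j < v ] ∣ B j ∩ T ∣                     ≡⟨ sum-cong-≗ (λ j → ∣p∩q∣≡∑ (B j) T) ⟩
      ∑[ j < v ] ∑[ x < v ] (χ (B j) x * χ T x)  ≡⟨ ∑-comm (λ j x → χ (B j) x * χ T x) ⟩
      ∑[ x < v ] ∑[ j < v ] (χ (B j) x * χ T x)  ≡⟨ sum-cong-≗ (λ x → *-distribʳ-sum (χ T x) (λ j → χ (B j) x)) ⟨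
      ∑[ x < v ] (∑[ j < v ] χ (B j) x * χ T x)  ≡⟨ sum-cong-≗ (λ x → cong (_* χ T x) (replication≡∑ x)) ⟨
      ∑[ x < v ] (replication B x * χ T x)       ∎
      where open ≡-Reasoning

    replication*[E]≡[E]*r : ∀ r x → replication B x * χ (E B r) x ≡ χ (E B r) x * r
    replication*[E]≡[E]*r r x rewrite lookup-E r x =
      trans (ℕP.*-comm (replication B x) _) ([y≟r]*y≡[y≟r]*r (replication B x) r)

    ∑τ≡∣E∣*r : ∀ r → ∑[ k < v ] τ B r (B k) ≡ ∣ E B r ∣ * r
    ∑τ≡∣E∣*r r = begin
      ∑[ k < v ] τ B r (B k)                      ≡⟨ ∑∣B∩T∣≡∑replication (E B r) ⟩
      ∑[ x < v ] (replication B x * χ (E B r) x)  ≡⟨ sum-cong-≗ (replication*[E]≡[E]*r r) ⟩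
      ∑[ x < v ] (χ (E B r) x * r)                ≡⟨ *-distribʳ-sum r (λ x → χ (E B r) x) ⟨
      ∑[ x < v ] χ (E B r) x * r                  ≡⟨ cong (_* r) (∣p∣≡∑ (E B r)) ⟨
      ∣ E B r ∣ * r                               ∎
      where open ≡-Reasoning

    τ-vanishes-above : ∀ {r} A → v < r → τ B r A ≡ 0
    τ-vanishes-above {r} A v<r = ℕP.n≤0⇒n≡0 (ℕP.≤-trans (∣p∩q∣≤∣q∣ A (E B r)) (ℕP.≤-reflexive E-empty))
      where
      open ≡-Reasoning
      x∉E : ∀ x → lookup (E B r) x ≡ false
      x∉E x = trans (lookup-E r x) (trans (isYes≗does (replication B x ≟ r)) (dec-false (replication B x ≟ r) replication≢r))
        where
        replication≢r : replication B x ≢ r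
        replication≢r refl = ℕP.<⇒≱ v<r (∣p∣≤n (tabulate (λ j → lookup (B j) x)))
      E-empty : ∣ E B r ∣ ≡ 0
      E-empty = begin
        ∣ E B r ∣               ≡⟨ ∣p∣≡∑ (E B r) ⟩
        ∑[ x < v ] χ (E B r) x  ≡⟨ sum-cong-≗ (cong [_]ᵇ ∘ x∉E) ⟩
        ∑[ x < v ] 0            ≡⟨ sum-replicate-zero v ⟩
        0                       ∎

  module TwoReplicationNumbers {v : ℕ} (B : Blocks v) {r₁ r₂ : ℕ} (r₁≢r₂ : r₁ ≢ r₂)
    (two-values : ∀ x → replication B x ≡ r₁ ⊎ replication B x ≡ r₂) where

    [E₁]+[E₂]≡1 : ∀ x → χ (E B r₁) x + χ (E B r₂) x ≡ 1
    [E₁]+[E₂]≡1 x rewrite lookup-E B r₁ x | lookup-E B r₂ x = [≟]-partition r₁≢r₂ (two-values x)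

    replication-split : ∀ x → replication B x ≡ r₁ * χ (E B r₁) x + r₂ * χ (E B r₂) x
    replication-split x = begin
      replication B x                              ≡⟨ ℕP.*-identityʳ _ ⟨
      replication B x * 1                          ≡⟨ cong (replication B x *_) ([E₁]+[E₂]≡1 x) ⟨
      replication B x * (e₁ + e₂)                  ≡⟨ ℕP.*-distribˡ-+ (replication B x) e₁ e₂ ⟩
      replication B x * e₁ + replication B x * e₂  ≡⟨ cong₂ _+_ (trans (replication*[E]≡[E]*r B r₁ x) (ℕP.*-comm e₁ r₁))
                                                                (trans (replication*[E]≡[E]*r B r₂ x) (ℕP.*-comm e₂ r₂)) ⟩
      r₁ * e₁ + r₂ * e₂                            ∎
      where
      open ≡-Reasoning
      e₁ = χ (E B r₁) x
      e₂ = χ (E B r₂) x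

    module _ (A : Subset v) where

      private
        A∩E₁ A∩E₂ : Fin v → ℕ
        A∩E₁ x = χ A x * χ (E B r₁) x
        A∩E₂ x = χ A x * χ (E B r₂) x

      ∣A∣≡τ₁+τ₂ : ∣ A ∣ ≡ τ B r₁ A + τ B r₂ A
      ∣A∣≡τ₁+τ₂ = begin
        ∣ A ∣                                     ≡⟨ ∣p∣≡∑ A ⟩
        ∑[ x < v ] χ A x                          ≡⟨ sum-cong-≗ (λ x → split (χ A x) ([E₁]+[E₂]≡1 x)) ⟩
        ∑[ x < v ] (A∩E₁ x + A∩E₂ x)              ≡⟨ ∑-distrib-+ A∩E₁ A∩E₂ ⟩
        ∑[ x < v ] A∩E₁ x + ∑[ x < v ] A∩E₂ x     ≡⟨ cong₂ _+_ (∣p∩q∣≡∑ A (E B r₁)) (∣p∩q∣≡∑ A (E B r₂)) ⟨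
        τ B r₁ A + τ B r₂ A                       ∎
        where
        open ≡-Reasoning
        split : ∀ a {e₁ e₂} → e₁ + e₂ ≡ 1 → a ≡ a * e₁ + a * e₂
        split a {e₁} {e₂} e₁+e₂≡1 =
          trans (sym (ℕP.*-identityʳ a)) (trans (cong (a *_) (sym e₁+e₂≡1)) (ℕP.*-distribˡ-+ a e₁ e₂))

      ∑replication≡ : ∑[ x < v ] (replication B x * χ A x) ≡ r₁ * τ B r₁ A + r₂ * τ B r₂ A
      ∑replication≡ = begin
        ∑[ x < v ] (replication B x * χ A x)                ≡⟨ sum-cong-≗ split ⟩
        ∑[ x < v ] (r₁ * A∩E₁ x + r₂ * A∩E₂ x)              ≡⟨ ∑-distrib-+ (λ x → r₁ * A∩E₁ x) (λ x → r₂ * A∩E₂ x) ⟩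
        ∑[ x < v ] (r₁ * A∩E₁ x) + ∑[ x < v ] (r₂ * A∩E₂ x) ≡⟨ cong₂ _+_ (*-distribˡ-sum r₁ A∩E₁) (*-distribˡ-sum r₂ A∩E₂) ⟨
        r₁ * ∑[ x < v ] A∩E₁ x + r₂ * ∑[ x < v ] A∩E₂ x     ≡⟨ cong₂ (λ s t → r₁ * s + r₂ * t) (∣p∩q∣≡∑ A (E B r₁)) (∣p∩q∣≡∑ A (E B r₂)) ⟨
        r₁ * τ B r₁ A + r₂ * τ B r₂ A                       ∎
        where
        open ≡-Reasoning
        regroup : ∀ r₁ r₂ a e₁ e₂ → (r₁ * e₁ + r₂ * e₂) * a ≡ r₁ * (a * e₁) + r₂ * (a * e₂)
        regroup = solve-∀
        split : ∀ x → replication B x * χ A x ≡ r₁ * A∩E₁ x + r₂ * A∩E₂ x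
        split x = trans (cong (_* χ A x) (replication-split x)) (regroup r₁ r₂ (χ A x) (χ (E B r₁) x) (χ (E B r₂) x))

  module _ {v λ′ : ℕ} {B : Blocks v} (D : IsRyserDesign v λ′ B) where

    ∑∣B∩Bk∣ : ∀ k → ∑[ j < v ] ∣ B j ∩ B k ∣ + λ′ ≡ ∣ B k ∣ + v * λ′
    ∑∣B∩Bk∣ k = trans (∑-except (λ j → ∣ B j ∩ B k ∣) k (λ j j≢k → IsRyserDesign.intersect D j k j≢k))
                      (cong (λ A → ∣ A ∣ + v * λ′) (∩-idem (B k)))

open Counting
open import Algebra.Properties.Semiring.Sum ℕP.+-*-semiring using (sum-syntax)
open import Data.Fin.Subset.Properties using (∣p∣≤n)

open import Data.Nat as ℕ using (ℕ)
open import Data.Integer using (ℤ; +_; _+_; _-_; _*_; _<_; 0ℤ; 1ℤ; -_; +<+; ≢-nonZero; positive)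
import Data.Integer as ℤ using (∣_∣; NonZero)
import Data.Integer.Properties as ℤP
open import Data.Integer.Coprimality using (Coprime; coprime-divisor)
open import Data.Integer.Divisibility.Signed using (divides; ∣ᵤ⇒∣; ∣⇒∣ᵤ)
open import Data.Integer.GCD using (gcd)
open import Data.Integer.Tactic.RingSolver using (solve-∀)
open import Data.Nat.Coprimality using (GCD≡1⇒coprime)
import Data.Nat.GCD as ℕGCD

gcd-quotients-coprime : ∀ {i j c d} → i ≢ 0ℤ → i ≡ gcd i j * c → j ≡ gcd i j * d → Coprime c d
gcd-quotients-coprime {i} {j} {c} {d} i≢0 i≡gc j≡gd = GCD≡1⇒coprime (ℕGCD.GCD-* {c = g} scaled)
  where
  g = ℕGCD.gcd ℤ.∣ i ∣ ℤ.∣ j ∣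
  instance
    g≢0 : ℕ.NonZero g
    g≢0 = ℕ.≢-nonZero (ℕGCD.gcd[m,n]≢0 ℤ.∣ i ∣ ℤ.∣ j ∣ (inj₁ (i≢0 ∘ ℤP.∣i∣≡0⇒i≡0)))
  ∣quotient∣*g : ∀ {k e} → k ≡ gcd i j * e → ℤ.∣ k ∣ ≡ ℤ.∣ e ∣ ℕ.* g
  ∣quotient∣*g {k} {e} k≡ge = trans (cong ℤ.∣_∣ k≡ge) (trans (ℤP.abs-* (gcd i j) e) (ℕP.*-comm g ℤ.∣ e ∣))
  scaled : ℕGCD.GCD (ℤ.∣ c ∣ ℕ.* g) (ℤ.∣ d ∣ ℕ.* g) (1 ℕ.* g)
  scaled = subst₂ (λ m n → ℕGCD.GCD m n (1 ℕ.* g)) (∣quotient∣*g i≡gc) (∣quotient∣*g j≡gd)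
             (subst (ℕGCD.GCD ℤ.∣ i ∣ ℤ.∣ j ∣) (sym (ℕP.*-identityˡ g)) (ℕGCD.gcd-GCD ℤ.∣ i ∣ ℤ.∣ j ∣))

gcd-quotients-ordered : ∀ {m n c d} → 0ℤ < n → n < m → m ≡ gcd m n * c → n ≡ gcd m n * d → 0ℤ < d × d < c
gcd-quotients-ordered {m} {n} {c} {d} 0<n n<m m≡gc n≡gd =
  ℤP.*-cancelˡ-<-nonNeg (gcd m n) (subst₂ _<_ (sym (ℤP.*-zeroʳ (gcd m n))) n≡gd 0<n) ,
  ℤP.*-cancelˡ-<-nonNeg (gcd m n) (subst₂ _<_ n≡gd m≡gc n<m)

coprime-linear-solution : ∀ {c d x y} → c ≢ 0ℤ → Coprime c d → c * x ≡ d * y → ∃ λ t → y ≡ t * c × x ≡ t * d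
coprime-linear-solution {c} {d} {x} {y} c≢0 coprime cx≡dy
  with ∣ᵤ⇒∣ (coprime-divisor c d y coprime (∣⇒∣ᵤ (divides x (trans (sym cx≡dy) (ℤP.*-comm c x)))))
... | divides t y≡tc = t , y≡tc , ℤP.*-cancelˡ-≡ c x (t * d) (begin
  c * x        ≡⟨ cx≡dy ⟩
  d * y        ≡⟨ cong (d *_) y≡tc ⟩
  d * (t * c)  ≡⟨ swap d t c ⟩
  c * (t * d)  ∎)
  where
  open ≡-Reasoning
  instance _ = ≢-nonZero c≢0
  swap : ∀ d t c → d * (t * c) ≡ c * (t * d)
  swap = solve-∀

proportional-by-gcd : ∀ {m n c d x y} → m ≢ 0ℤ → m ≡ gcd m n * c → n ≡ gcd m n * d → m * x ≡ n * y →
                      ∃ λ t → y ≡ t * c × x ≡ t * d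
proportional-by-gcd {m} {n} {c} {d} {x} {y} m≢0 m≡gc n≡gd mx≡ny =
  coprime-linear-solution c≢0 (gcd-quotients-coprime m≢0 m≡gc n≡gd) (ℤP.*-cancelˡ-≡ (gcd m n) (c * x) (d * y) (begin
    gcd m n * (c * x)  ≡⟨ ℤP.*-assoc (gcd m n) c x ⟨
    gcd m n * c * x    ≡⟨ cong (_* x) m≡gc ⟨
    m * x              ≡⟨ mx≡ny ⟩
    n * y              ≡⟨ cong (_* y) n≡gd ⟩
    gcd m n * d * y    ≡⟨ ℤP.*-assoc (gcd m n) d y ⟩
    gcd m n * (d * y)  ∎))
  where
  open ≡-Reasoning
  c≢0 : c ≢ 0ℤ
  c≢0 refl = m≢0 (trans m≡gc (ℤP.*-zeroʳ (gcd m n)))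
  g≢0 : gcd m n ≢ 0ℤ
  g≢0 g≡0 = m≢0 (trans m≡gc (cong (_* c) g≡0))
  instance
    _ = ≢-nonZero g≢0

i<j⇒0<j-i : ∀ {i j} → i < j → 0ℤ < j - i
i<j⇒0<j-i {i} {j} i<j = subst (_< j - i) (ℤP.+-inverseʳ i) (ℤP.+-monoˡ-< (- i) i<j)

i-j≡k⇒i≡j+k : ∀ i j {k} → i - j ≡ k → i ≡ j + k
i-j≡k⇒i≡j+k i j refl = sym (shuffle i j)
  where
  shuffle : ∀ i j → j + (i - j) ≡ i
  shuffle = solve-∀

module _ {k : ℤ} (0<k : 0ℤ < k) (i : ℤ) {t : ℤ} where

  private instance _ = positive 0<k

  i<i+t*k : 0ℤ < t → i < i + t * k
  i<i+t*k 0<t = subst (_< i + t * k) (ℤP.+-identityʳ i) (ℤP.+-monoʳ-< i (ℤP.*-monoʳ-<-pos k 0<t))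

  i+t*k<i : t < 0ℤ → i + t * k < i
  i+t*k<i t<0 = subst (i + t * k <_) (ℤP.+-identityʳ i) (ℤP.+-monoʳ-< i (ℤP.*-monoʳ-<-pos k t<0))

first-⇔ : ∀ {a b c a′ b′ c′} {A : Set a} {B : Set b} {C : Set c} {A′ : Set a′} {B′ : Set b′} {C′ : Set c′} →
  Tri A B C → Tri A′ B′ C′ → (A → A′) → (B → B′) → (C → C′) → A ⇔ A′
first-⇔ tri tri′ f g h = mk⇔ f (reflect tri tri′)
  where
  reflect : Tri _ _ _ → Tri _ _ _ → _ → _
  reflect (tri< a _ _) _ _ = a
  reflect (tri≈ _ b _) (tri< _ ¬b′ _) _ = ⊥-elim (¬b′ (g b))
  reflect (tri> _ _ c) (tri< _ _ ¬c′) _ = ⊥-elim (¬c′ (h c))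
  reflect _ (tri≈ ¬a′ _ _) a′ = ⊥-elim (¬a′ a′)
  reflect _ (tri> ¬a′ _ _) a′ = ⊥-elim (¬a′ a′)

tri-rotate : ∀ {a b c} {A : Set a} {B : Set b} {C : Set c} → Tri A B C → Tri B C A
tri-rotate (tri< a ¬b ¬c) = tri> ¬b ¬c a
tri-rotate (tri≈ ¬a b ¬c) = tri< b ¬c ¬a
tri-rotate (tri> ¬a ¬b c) = tri≈ ¬b c ¬a

tri-⇔ : ∀ {a b c a′ b′ c′} {A : Set a} {B : Set b} {C : Set c} {A′ : Set a′} {B′ : Set b′} {C′ : Set c′} →
  Tri A B C → Tri A′ B′ C′ → (A → A′) → (B → B′) → (C → C′) → (A ⇔ A′) × (B ⇔ B′) × (C ⇔ C′)
tri-⇔ tri tri′ f g h =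
  first-⇔ tri tri′ f g h ,
  first-⇔ (tri-rotate tri) (tri-rotate tri′) g h f ,
  first-⇔ (tri-rotate (tri-rotate tri)) (tri-rotate (tri-rotate tri′)) h f g

size-from-τ : ∀ {a τ₁ τ₂ λ′ : ℕ} {c d t : ℤ} →
              a ≡ τ₁ ℕ.+ τ₂ → + τ₂ ≡ + λ′ + t * c → + λ′ ≡ + τ₁ + t * d → + a ≡ + (2 ℕ.* λ′) + t * (c - d)
size-from-τ {a} {τ₁} {τ₂} {λ′} {c} {d} {t} a≡τ₁+τ₂ τ₂≡λ+tc λ≡τ₁+td = begin
  + a                                  ≡⟨ cong +_ a≡τ₁+τ₂ ⟩
  + τ₁ + + τ₂                          ≡⟨ cong (λ T₂ → + τ₁ + T₂) τ₂≡λ+tc ⟩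
  + τ₁ + (+ λ′ + t * c)                ≡⟨ regroup (+ τ₁) (+ λ′) t c d ⟩
  + λ′ + (+ τ₁ + t * d) + t * (c - d)  ≡⟨ cong (λ L → + λ′ + L + t * (c - d)) λ≡τ₁+td ⟨
  + (λ′ ℕ.+ λ′) + t * (c - d)          ≡⟨ cong (λ m → + (λ′ ℕ.+ m) + t * (c - d)) (ℕP.+-identityʳ λ′) ⟨
  + (2 ℕ.* λ′) + t * (c - d)           ∎
  where
  open ≡-Reasoning
  regroup : ∀ T₁ L t c d → T₁ + (L + t * c) ≡ L + (T₁ + t * d) + t * (c - d)
  regroup = solve-∀

size-classification : ∀ {n} (λ′ : ℕ) (A : Subset n) {τ₁ τ₂ : ℕ} {c d t : ℤ} →
  0ℤ < d → d < c → ∣ A ∣ ≡ τ₁ ℕ.+ τ₂ → + τ₂ - + λ′ ≡ t * c → + λ′ - + τ₁ ≡ t * d →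
  (+ ∣ A ∣ ≡ + (2 ℕ.* λ′) + t * (c - d))
  × (0ℤ < t ⇔ Large λ′ A)
  × (t ≡ 0ℤ ⇔ Average λ′ A)
  × (t < 0ℤ ⇔ Small λ′ A)
  × (Average λ′ A → τ₁ ≡ λ′ × τ₂ ≡ λ′)
  × (Small λ′ A → λ′ ℕ.< τ₁ × τ₂ ℕ.< λ′)
  × (Large λ′ A → λ′ ℕ.< τ₂ × τ₁ ℕ.< λ′)
size-classification λ′ A {τ₁} {τ₂} {c} {d} {t} 0<d d<c ∣A∣≡τ₁+τ₂ τ₂-λ≡tc λ-τ₁≡td =
  size , large⇔ , average⇔ , small⇔ ,
  τ-at-zero ∘ Equivalence.from average⇔ ,
  τ-at-negative ∘ Equivalence.from small⇔ ,
  τ-at-positive ∘ Equivalence.from large⇔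
  where
  0<c = ℤP.<-trans 0<d d<c
  0<c-d = i<j⇒0<j-i d<c
  τ₂≡λ+tc : + τ₂ ≡ + λ′ + t * c
  τ₂≡λ+tc = i-j≡k⇒i≡j+k (+ τ₂) (+ λ′) τ₂-λ≡tc
  λ≡τ₁+td : + λ′ ≡ + τ₁ + t * d
  λ≡τ₁+td = i-j≡k⇒i≡j+k (+ λ′) (+ τ₁) λ-τ₁≡td
  size : + ∣ A ∣ ≡ + (2 ℕ.* λ′) + t * (c - d)
  size = size-from-τ {c = c} {d} {t} ∣A∣≡τ₁+τ₂ τ₂≡λ+tc λ≡τ₁+td
  shrinks : t < 0ℤ → Small λ′ A
  shrinks t<0 = ℤP.drop‿+<+ (subst (_< + (2 ℕ.* λ′)) (sym size) (i+t*k<i 0<c-d _ t<0))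
  stays : t ≡ 0ℤ → Average λ′ A
  stays refl = ℤP.+-injective (trans size (ℤP.+-identityʳ _))
  grows : 0ℤ < t → Large λ′ A
  grows 0<t = ℤP.drop‿+<+ (subst (+ (2 ℕ.* λ′) <_) (sym size) (i<i+t*k 0<c-d _ 0<t))
  classes = tri-⇔ (ℤP.<-cmp t 0ℤ) (ℕP.<-cmp ∣ A ∣ (2 ℕ.* λ′)) shrinks stays grows
  small⇔ = proj₁ classes
  average⇔ = proj₁ (proj₂ classes)
  large⇔ = proj₂ (proj₂ classes)
  τ-at-zero : t ≡ 0ℤ → τ₁ ≡ λ′ × τ₂ ≡ λ′
  τ-at-zero refl = ℤP.+-injective (sym (trans λ≡τ₁+td (ℤP.+-identityʳ _))) ,
                   ℤP.+-injective (trans τ₂≡λ+tc (ℤP.+-identityʳ _))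
  τ-at-negative : t < 0ℤ → λ′ ℕ.< τ₁ × τ₂ ℕ.< λ′
  τ-at-negative t<0 = ℤP.drop‿+<+ (subst (_< + τ₁) (sym λ≡τ₁+td) (i+t*k<i 0<d _ t<0)) ,
                      ℤP.drop‿+<+ (subst (_< + λ′) (sym τ₂≡λ+tc) (i+t*k<i 0<c _ t<0))
  τ-at-positive : 0ℤ < t → λ′ ℕ.< τ₂ × τ₁ ℕ.< λ′
  τ-at-positive 0<t = ℤP.drop‿+<+ (subst (+ λ′ <_) (sym τ₂≡λ+tc) (i<i+t*k 0<c _ 0<t)) ,
                      ℤP.drop‿+<+ (subst (+ τ₁ <_) (sym λ≡τ₁+td) (i<i+t*k 0<d _ 0<t))

balance-of-counts : ∀ R₁ R₂ V T₁ T₂ L → R₁ * T₁ + R₂ * T₂ + L ≡ (T₁ + T₂) + V * L → R₁ + R₂ ≡ V + 1ℤ →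
          (R₁ - 1ℤ) * (L - T₁) ≡ (R₂ - 1ℤ) * (T₂ - L)
balance-of-counts R₁ R₂ V T₁ T₂ L counted R₁+R₂≡V+1 = ℤP.i-j≡0⇒i≡j _ _ (begin
  (R₁ - 1ℤ) * (L - T₁) - (R₂ - 1ℤ) * (T₂ - L)              ≡⟨ expand R₁ R₂ T₁ T₂ L ⟩
  (T₁ + T₂) + (R₁ + R₂) * L - (R₁ * T₁ + R₂ * T₂ + L + L)  ≡⟨ cong₂ (λ S C → (T₁ + T₂) + S * L - (C + L)) R₁+R₂≡V+1 counted ⟩
  (T₁ + T₂) + (V + 1ℤ) * L - ((T₁ + T₂) + V * L + L)       ≡⟨ cancel T₁ T₂ V L ⟩
  0ℤ                                                       ∎)
  where
  open ≡-Reasoning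
  expand : ∀ R₁ R₂ T₁ T₂ L → (R₁ - 1ℤ) * (L - T₁) - (R₂ - 1ℤ) * (T₂ - L) ≡
                             (T₁ + T₂) + (R₁ + R₂) * L - (R₁ * T₁ + R₂ * T₂ + L + L)
  expand = solve-∀
  cancel : ∀ T₁ T₂ V L → (T₁ + T₂) + (V + 1ℤ) * L - ((T₁ + T₂) + V * L + L) ≡ 0ℤ
  cancel = solve-∀

i*j≡0*l⇒j≡0 : ∀ {i j k l} → i ≢ 0ℤ → i * j ≡ k * l → k ≡ 0ℤ → j ≡ 0ℤ
i*j≡0*l⇒j≡0 {i} {j} {k} {l} i≢0 ij≡kl k≡0
  with ℤP.i*j≡0⇒i≡0∨j≡0 i (trans ij≡kl (trans (cong (_* l) k≡0) (ℤP.*-zeroˡ l)))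
... | inj₁ i≡0 = ⊥-elim (i≢0 i≡0)
... | inj₂ j≡0 = j≡0

module RyserReplication {v λ′ : ℕ} {B : Blocks v} (D : IsRyserDesign v λ′ B) {r₁ r₂ : ℕ} (r₂<r₁ : r₂ ℕ.< r₁)
  (r₁+r₂≡v+1 : r₁ ℕ.+ r₂ ≡ v ℕ.+ 1) (two-values : ∀ x → replication B x ≡ r₁ ⊎ replication B x ≡ r₂) where

  open TwoReplicationNumbers B (ℕP.>⇒≢ r₂<r₁) two-values public

  block-equation : ∀ k → r₁ ℕ.* τ B r₁ (B k) ℕ.+ r₂ ℕ.* τ B r₂ (B k) ℕ.+ λ′ ≡ ∣ B k ∣ ℕ.+ v ℕ.* λ′
  block-equation k =
    trans (cong (ℕ._+ λ′) (sym (trans (∑∣B∩T∣≡∑replication B (B k)) (∑replication≡ (B k))))) (∑∣B∩Bk∣ D k)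

  τ-balance : ∀ k → (+ r₁ - 1ℤ) * (+ λ′ - + τ B r₁ (B k)) ≡ (+ r₂ - 1ℤ) * (+ τ B r₂ (B k) - + λ′)
  τ-balance k = balance-of-counts (+ r₁) (+ r₂) (+ v) (+ τ₁) (+ τ₂) (+ λ′) counted (cong +_ r₁+r₂≡v+1)
    where
    open ≡-Reasoning
    τ₁ = τ B r₁ (B k)
    τ₂ = τ B r₂ (B k)
    counted : + r₁ * + τ₁ + + r₂ * + τ₂ + + λ′ ≡ (+ τ₁ + + τ₂) + + v * + λ′
    counted = begin
      + r₁ * + τ₁ + + r₂ * + τ₂ + + λ′    ≡⟨ cong₂ (λ a b → a + b + + λ′) (ℤP.pos-* r₁ τ₁) (ℤP.pos-* r₂ τ₂) ⟨
      + (r₁ ℕ.* τ₁ ℕ.+ r₂ ℕ.* τ₂ ℕ.+ λ′)  ≡⟨ cong +_ (block-equation k) ⟩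
      + (∣ B k ∣ ℕ.+ v ℕ.* λ′)            ≡⟨ cong₂ _+_ (cong +_ (∣A∣≡τ₁+τ₂ (B k))) (ℤP.pos-* v λ′) ⟩
      (+ τ₁ + + τ₂) + + v * + λ′          ∎

  r₂≢0 : Fin v → r₂ ≢ 0
  r₂≢0 k refl = ℕP.<-irrefl refl (begin-strict
    λ′                                <⟨ IsRyserDesign.bigger D k ⟩
    ∣ B k ∣                           ≤⟨ ℕP.m≤m+n ∣ B k ∣ (v ℕ.* λ′) ⟩
    ∣ B k ∣ ℕ.+ v ℕ.* λ′              ≡⟨ block-equation k ⟨
    r₁ ℕ.* τ B r₁ (B k) ℕ.+ 0 ℕ.+ λ′  ≡⟨ cong (λ τ₁ → r₁ ℕ.* τ₁ ℕ.+ 0 ℕ.+ λ′) τ₁≡0 ⟩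
    r₁ ℕ.* 0 ℕ.+ 0 ℕ.+ λ′             ≡⟨ cong (λ z → z ℕ.+ 0 ℕ.+ λ′) (ℕP.*-zeroʳ r₁) ⟩
    λ′                                ∎)
    where
    open ℕP.≤-Reasoning
    v<r₁ : v ℕ.< r₁
    v<r₁ = subst (v ℕ.<_) (trans (sym r₁+r₂≡v+1) (ℕP.+-identityʳ r₁)) (ℕP.m<m+n v (ℕ.s≤s ℕ.z≤n))
    τ₁≡0 : τ B r₁ (B k) ≡ 0
    τ₁≡0 = τ-vanishes-above B (B k) v<r₁

  r₂≢1 : r₂ ≢ 1
  r₂≢1 r₂≡1 = all-sizes-equal (IsRyserDesign.nonUniform D)
    where
    τ₂ : Fin v → ℕ
    τ₂ k = τ B r₂ (B k)
    r₁-1≢0 : + r₁ - 1ℤ ≢ 0ℤ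
    r₁-1≢0 r₁-1≡0 =
      ℕP.<-irrefl (sym (ℤP.+-injective (ℤP.i-j≡0⇒i≡j (+ r₁) 1ℤ r₁-1≡0))) (subst (ℕ._< r₁) r₂≡1 r₂<r₁)
    τ₁≡λ : ∀ k → τ B r₁ (B k) ≡ λ′
    τ₁≡λ k = ℤP.+-injective (sym (ℤP.i-j≡0⇒i≡j (+ λ′) (+ τ B r₁ (B k))
               (i*j≡0*l⇒j≡0 r₁-1≢0 (τ-balance k) (cong (λ r → + r - 1ℤ) r₂≡1))))
    ∣Bk∣≡λ+τ₂ : ∀ k → ∣ B k ∣ ≡ λ′ ℕ.+ τ₂ k
    ∣Bk∣≡λ+τ₂ k = trans (∣A∣≡τ₁+τ₂ (B k)) (cong (ℕ._+ τ₂ k) (τ₁≡λ k))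
    1≤τ₂ : ∀ k → 1 ℕ.≤ τ₂ k
    1≤τ₂ k = ℕP.+-cancelˡ-< λ′ 0 (τ₂ k)
               (subst₂ ℕ._<_ (sym (ℕP.+-identityʳ λ′)) (∣Bk∣≡λ+τ₂ k) (IsRyserDesign.bigger D k))
    ∑τ₂≤v : ∑[ k < v ] τ₂ k ℕ.≤ v
    ∑τ₂≤v = begin
      ∑[ k < v ] τ₂ k   ≡⟨ ∑τ≡∣E∣*r B r₂ ⟩
      ∣ E B r₂ ∣ ℕ.* r₂  ≡⟨ cong (∣ E B r₂ ∣ ℕ.*_) r₂≡1 ⟩
      ∣ E B r₂ ∣ ℕ.* 1   ≡⟨ ℕP.*-identityʳ ∣ E B r₂ ∣ ⟩
      ∣ E B r₂ ∣         ≤⟨ ∣p∣≤n (E B r₂) ⟩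
      v                 ∎
      where open ℕP.≤-Reasoning
    τ₂≡1 : ∀ k → τ₂ k ≡ 1
    τ₂≡1 k = ℕP.≤-antisym (∑≤n⇒≤1 τ₂ 1≤τ₂ ∑τ₂≤v k) (1≤τ₂ k)
    all-sizes-equal : ¬ ∃₂ λ j k → ∣ B j ∣ ≢ ∣ B k ∣
    all-sizes-equal (j , k , ∣Bj∣≢∣Bk∣) = ∣Bj∣≢∣Bk∣ (begin
      ∣ B j ∣           ≡⟨ ∣Bk∣≡λ+τ₂ j ⟩
      λ′ ℕ.+ τ₂ j       ≡⟨ cong (λ′ ℕ.+_) (trans (τ₂≡1 j) (sym (τ₂≡1 k))) ⟩
      λ′ ℕ.+ τ₂ k       ≡⟨ ∣Bk∣≡λ+τ₂ k ⟨
      ∣ B k ∣           ∎)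
      where open ≡-Reasoning

  1<r₂ : Fin v → 1 ℕ.< r₂
  1<r₂ k = ℕP.≤∧≢⇒< (ℕP.n≢0⇒n>0 (r₂≢0 k)) (r₂≢1 ∘ sym)

mainTheorem1 : (v λ′ : ℕ) (B : Blocks v) → IsRyserDesign v λ′ B →
    (r₁ r₂ : ℕ) → r₂ ℕ.< r₁ → r₁ ℕ.+ r₂ ≡ v ℕ.+ 1 →
    (∀ x → replication B x ≡ r₁ ⊎ replication B x ≡ r₂) →
    (c d : ℤ) →
    (+ r₁ - 1ℤ) ≡ gcd (+ r₁ - 1ℤ) (+ r₂ - 1ℤ) * c →
    (+ r₂ - 1ℤ) ≡ gcd (+ r₁ - 1ℤ) (+ r₂ - 1ℤ) * d →
    (i : Fin v) →
    ∃ λ (t : ℤ) →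
      (+ ∣ B i ∣ ≡ + (2 ℕ.* λ′) + t * (c - d))
      × (0ℤ < t ⇔ Large λ′ (B i))
      × (t ≡ 0ℤ ⇔ Average λ′ (B i))
      × (t < 0ℤ ⇔ Small λ′ (B i))
      × (Average λ′ (B i) → τ B r₁ (B i) ≡ λ′ × τ B r₂ (B i) ≡ λ′)
      × (Small λ′ (B i) → λ′ ℕ.< τ B r₁ (B i) × τ B r₂ (B i) ℕ.< λ′)
      × (Large λ′ (B i) → λ′ ℕ.< τ B r₂ (B i) × τ B r₁ (B i) ℕ.< λ′)
mainTheorem1 v λ′ B D r₁ r₂ r₂<r₁ r₁+r₂≡v+1 two-values c d r₁-1≡gc r₂-1≡gd i =
  let 0<d , d<c = gcd-quotients-ordered 0<r₂-1 r₂-1<r₁-1 r₁-1≡gc r₂-1≡gd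
      t , τ₂-λ≡tc , λ-τ₁≡td = proportional-by-gcd r₁-1≢0 r₁-1≡gc r₂-1≡gd (τ-balance i)
  in t , size-classification λ′ (B i) 0<d d<c (∣A∣≡τ₁+τ₂ (B i)) τ₂-λ≡tc λ-τ₁≡td
  where
  open RyserReplication D r₂<r₁ r₁+r₂≡v+1 two-values
  0<r₂-1 : 0ℤ < + r₂ - 1ℤ
  0<r₂-1 = ℤP.+-monoˡ-< (- 1ℤ) (+<+ (1<r₂ i))
  r₂-1<r₁-1 : + r₂ - 1ℤ < + r₁ - 1ℤ
  r₂-1<r₁-1 = ℤP.+-monoˡ-< (- 1ℤ) (+<+ r₂<r₁)
  r₁-1≢0 : + r₁ - 1ℤ ≢ 0ℤ
  r₁-1≢0 r₁-1≡0 = ℤP.<-irrefl (sym r₁-1≡0) (ℤP.<-trans 0<r₂-1 r₂-1<r₁-1)
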